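{- Let $b\ge2$ and $n\ge2$. Then (i) there are integers $m\ge1$ and $k$ with $0\le k\le (b-1)m-2$ such that $K(n)=b^m+1+k$; (ii) if $b$ is odd, then both $K(n)$ and this $k$ are even.
   Context: Fix a base $b\ge2$. For $v\in\mathbb{N}$, $s(v)$ is the sum of the base-$b$ digits of $v$, $f(v)=v+s(v)$, and $F(u)=|\{v\in\mathbb{N}: f(v)=u\}|$. For $n\ge1$, $K(n)$ denotes the smallest $u\in\mathbb{N}$ with $F(u)=n$. -}

module Defs where

open import Data.Nat using (ℕ; zero; suc; _+_; _*_; _<_; NonZero)
open import Data.Nat.DivMod using (_/_; _%_)
open import Data.Nat.Divisibility using (_∣_)
open import Data.Nat.Properties using (_≟_)
open import Data.List using (List; length; filter; upTo)
open import Data.Product using (_×_)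
open import Relation.Binary.PropositionalEquality using (_≡_; _≢_)

-- digit sum in base b, computed with fuel (fuel v suffices since v / b < v for v > 0, b ≥ 2)
digitSumAux : (b : ℕ) .{{_ : NonZero b}} → ℕ → ℕ → ℕ
digitSumAux b zero    v = 0
digitSumAux b (suc t) v = v % b + digitSumAux b t (v / b)

s : (b : ℕ) .{{_ : NonZero b}} → ℕ → ℕ
s b v = digitSumAux b v v

f : (b : ℕ) .{{_ : NonZero b}} → ℕ → ℕ
f b v = v + s b v

-- F(u) = |{ v ∈ ℕ : f(v) = u }|; since f(v) ≥ v, all such v lie in {0,…,u}
F : (b : ℕ) .{{_ : NonZero b}} → ℕ → ℕ
F b u = length (filter (λ v → f b v ≟ u) (upTo (suc u)))

IsK : (b : ℕ) .{{_ : NonZero b}} → ℕ → ℕ → Set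
IsK b n u = F b u ≡ n × (∀ w → w < u → F b w ≢ n)

Even : ℕ → Set
Even n = 2 ∣ n

Odd : ℕ → Set
Odd n = 2 ∣ suc n

-- Let p < q be the least and the largest preimage of u = K(n) under f, and let j be the
-- highest digit position where p and q differ, c = ⌊p / bʲ⌋ and r = p mod bʲ. Every preimage v
-- of u lies between p and q, so ⌊v / bʲ⌋ differs from c only in its last digit and without a
-- carry. Hence translation by c·bʲ adds the constant c·bʲ + s(c) to f and maps the preimages
-- of u′ = f(r) bijectively onto those of u, so F(u′) = F(u); minimality of K(n) forces c = 0,
-- that is p < bʲ ≤ q. Then bʲ + 1 ≤ f(q) = u = f(p) < bʲ + (b − 1)j. For odd b, v and s(v)
-- have the same parity, so u is even, and so is bʲ + 1.

module Submission where

open import Defs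
open import Data.Bool using (if_then_else_)
open import Data.Nat using (ℕ; zero; suc; _+_; _*_; _∸_; _^_; _≤_; _<_; z≤n; s≤s; NonZero)
open import Data.Nat.Properties
open import Algebra.Properties.CommutativeSemigroup +-commutativeSemigroup
  using (x∙yz≈y∙xz; xy∙z≈xz∙y; interchange)
open import Data.Nat.DivMod
open import Data.Nat.Induction using (<-rec)
open import Data.Nat.Divisibility using (_∣_; divides; divides-refl; ∣m+n∣m⇒∣n; ∣m∣n⇒∣m+n; n∣m*n; ∣n⇒∣m*n)
open import Data.Nat.Tactic.RingSolver using (solve-∀)
open import Data.List using (length; filter; upTo; _++_; [_])
open import Data.List.Properties using (upTo-∷ʳ; filter-++; length-++)
open import Data.Product using (_×_; _,_; proj₁; proj₂; ∃-syntax)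
open import Data.Sum using (inj₁; inj₂)
open import Function using (_∘′_)
open import Function.Bundles using (_⇔_; mk⇔)
open import Relation.Nullary using (¬_; yes; no; does; contradiction)
open import Relation.Nullary.Decidable using (dec-true; dec-false; does-⇔)
open import Relation.Unary using (Decidable)
open import Relation.Binary.PropositionalEquality hiding ([_])

-- Counting witnesses below a bound

count : {P : ℕ → Set} → Decidable P → ℕ → ℕ
count P? zero    = 0
count P? (suc N) = count P? N + (if does (P? N) then 1 else 0)

module _ {P : ℕ → Set} (P? : Decidable P) where

  length-filter-upTo : ∀ N → length (filter P? (upTo N)) ≡ count P? N
  length-filter-upTo zero    = refl
  length-filter-upTo (suc N) = begin
    length (filter P? (upTo (suc N)))              ≡⟨ cong (length ∘′ filter P?) (upTo-∷ʳ N) ⟨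
    length (filter P? (upTo N ++ [ N ]))           ≡⟨ cong length (filter-++ P? (upTo N) [ N ]) ⟩
    length (filter P? (upTo N) ++ filter P? [ N ]) ≡⟨ length-++ (filter P? (upTo N)) ⟩
    length (filter P? (upTo N)) + length (filter P? [ N ])
      ≡⟨ cong₂ _+_ (length-filter-upTo N) (length-filter-singleton N) ⟩
    count P? (suc N)                               ∎
    where
    open ≡-Reasoning
    length-filter-singleton : ∀ v → length (filter P? [ v ]) ≡ (if does (P? v) then 1 else 0)
    length-filter-singleton v with P? v
    ... | yes _ = refl
    ... | no _  = refl

  count-none : ∀ {N} → (∀ v → v < N → ¬ P v) → count P? N ≡ 0
  count-none {zero}  _    = refl
  count-none {suc N} none rewrite dec-false (P? N) (none N ≤-refl) =
    trans (+-identityʳ _) (count-none (λ v v<N → none v (m<n⇒m<1+n v<N)))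

  count≡0⇒none : ∀ {N} → count P? N ≡ 0 → ∀ v → v < N → ¬ P v
  count≡0⇒none {suc N} c≡0 v v<1+N Pv with m≤n⇒m<n∨m≡n (≤-pred v<1+N)
  ... | inj₁ v<N  = count≡0⇒none (m+n≡0⇒m≡0 (count P? N) c≡0) v v<N Pv
  ... | inj₂ refl rewrite dec-true (P? v) Pv = 1+n≢0 (trans (+-comm 1 _) c≡0)

  count-beyond : ∀ {N} → (∀ v → N ≤ v → ¬ P v) → ∀ k → count P? (k + N) ≡ count P? N
  count-beyond none zero    = refl
  count-beyond {N} none (suc k) rewrite dec-false (P? (k + N)) (none (k + N) (m≤n+m N k)) =
    trans (+-identityʳ _) (count-beyond none k)

  count-shift : ∀ {T} → (∀ v → v < T → ¬ P v) → ∀ L → count P? (T + L) ≡ count (λ w → P? (T + w)) L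
  count-shift {T} none zero    = trans (cong (count P?) (+-identityʳ T)) (count-none none)
  count-shift {T} none (suc L) rewrite +-suc T L = cong (_+ _) (count-shift none L)

  count-least : ∀ {N} → 1 ≤ count P? N → ∃[ p ] (p < N × P p × ∀ v → v < p → ¬ P v)
  count-least {suc N} 1≤c with count P? N in c≡
  ... | suc _ with p , p<N , Pp , below ← count-least (subst (1 ≤_) (sym c≡) (s≤s z≤n)) =
    p , m<n⇒m<1+n p<N , Pp , below
  ... | zero with P? N
  ...   | yes PN = N , ≤-refl , PN , count≡0⇒none c≡

  count-greatest : ∀ {N} → 1 ≤ count P? N →
    ∃[ q ] (q < N × P q × (∀ v → q < v → v < N → ¬ P v) × count P? N ≡ suc (count P? q))
  count-greatest {suc N} 1≤c with P? N
  ... | yes PN = N , ≤-refl , PN , (λ v N<v v<1+N _ → <⇒≱ N<v (≤-pred v<1+N)) , +-comm _ 1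
  ... | no ¬PN with q , q<N , Pq , above , c≡ ← count-greatest (subst (1 ≤_) (+-identityʳ _) 1≤c) =
    q , m<n⇒m<1+n q<N , Pq , above′ , trans (+-identityʳ _) c≡
    where
    above′ : ∀ v → q < v → v < suc N → ¬ P v
    above′ v q<v v<1+N with m≤n⇒m<n∨m≡n (≤-pred v<1+N)
    ... | inj₁ v<N  = above v q<v v<N
    ... | inj₂ refl = ¬PN

  count≥2⇒extremes : ∀ {N} → 2 ≤ count P? N →
    ∃[ p ] ∃[ q ] (p < q × P p × P q × ∀ v → v < N → P v → p ≤ v × v ≤ q)
  count≥2⇒extremes 2≤c
    with q , q<N , Pq , above , c≡ ← count-greatest (≤-trans (s≤s z≤n) 2≤c)
    with p , p<q , Pp , below ← count-least (≤-pred (subst (2 ≤_) c≡ 2≤c)) =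
    p , q , p<q , Pp , Pq , λ v v<N Pv → ≮⇒≥ (λ v<p → below v v<p Pv) , ≮⇒≥ (λ q<v → above v q<v v<N Pv)

count-cong : ∀ {P Q : ℕ → Set} (P? : Decidable P) (Q? : Decidable Q) →
  (∀ v → P v ⇔ Q v) → ∀ N → count P? N ≡ count Q? N
count-cong P? Q? P⇔Q zero    = refl
count-cong P? Q? P⇔Q (suc N) =
  cong₂ (λ c d → c + (if d then 1 else 0)) (count-cong P? Q? P⇔Q N) (does-⇔ (P⇔Q N) (P? N) (Q? N))

module _ {d : ℕ} .{{_ : NonZero d}} where

  [r+q*d]%d≡r : ∀ {r} q → r < d → (r + q * d) % d ≡ r
  [r+q*d]%d≡r {r} q r<d = trans ([m+kn]%n≡m%n r q d) (m<n⇒m%n≡m r<d)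

  [r+q*d]/d≡q : ∀ {r} q → r < d → (r + q * d) / d ≡ q
  [r+q*d]/d≡q {r} q r<d = begin
    (r + q * d) / d   ≡⟨ +-distrib-/-∣ʳ r (divides-refl q) ⟩
    r / d + q * d / d ≡⟨ cong₂ _+_ (m<n⇒m/n≡0 r<d) (m*n/n≡m q d) ⟩
    q                 ∎
    where open ≡-Reasoning

  -- y lies in the same block of d consecutive numbers as x, so y % d = x % d + (y ∸ x).
  %-room : ∀ {x y z} → x ≤ y → y ≤ z → x / d ≡ z / d → x % d + (y ∸ x) < d
  %-room {x} {y} {z} x≤y y≤z x/d≡z/d = subst (_< d) (sym x%d+[y∸x]≡y%d) (m%n<n y d)
    where
    open ≡-Reasoning
    y/d≡x/d : y / d ≡ x / d
    y/d≡x/d = ≤-antisym (≤-trans (/-monoˡ-≤ d y≤z) (≤-reflexive (sym x/d≡z/d))) (/-monoˡ-≤ d x≤y)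
    x%d+[y∸x]≡y%d : x % d + (y ∸ x) ≡ y % d
    x%d+[y∸x]≡y%d = +-cancelʳ-≡ (x / d * d) _ _ (begin
      x % d + (y ∸ x) + x / d * d ≡⟨ xy∙z≈xz∙y (x % d) (y ∸ x) _ ⟩
      x % d + x / d * d + (y ∸ x) ≡⟨ cong (_+ (y ∸ x)) (m≡m%n+[m/n]*n x d) ⟨
      x + (y ∸ x)                 ≡⟨ m+[n∸m]≡n x≤y ⟩
      y                           ≡⟨ m≡m%n+[m/n]*n y d ⟩
      y % d + y / d * d           ≡⟨ cong (λ k → y % d + k * d) y/d≡x/d ⟩
      y % d + x / d * d           ∎)

-- Base-b digit sums and the preimages of K(n)

module DigitSum (b : ℕ) .{{_ : NonZero b}} (1<b : 1 < b) where

  0%b≡0 : 0 % b ≡ 0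
  0%b≡0 = m*n%n≡0 0 b

  digitSumAux-zero : ∀ t → digitSumAux b t 0 ≡ 0
  digitSumAux-zero zero    = refl
  digitSumAux-zero (suc t) =
    trans (cong₂ (λ r q → r + digitSumAux b t q) 0%b≡0 (0/n≡0 b)) (digitSumAux-zero t)

  digitSumAux-fuel : ∀ {t t′} v → v ≤ t → v ≤ t′ → digitSumAux b t v ≡ digitSumAux b t′ v
  digitSumAux-fuel {t} {t′} zero _ _ = trans (digitSumAux-zero t) (sym (digitSumAux-zero t′))
  digitSumAux-fuel {suc t} {suc t′} v@(suc _) v≤1+t v≤1+t′ =
    cong (v % b +_) (digitSumAux-fuel (v / b) (≤-pred (≤-trans v/b<v v≤1+t)) (≤-pred (≤-trans v/b<v v≤1+t′)))
    where
    v/b<v : v / b < v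
    v/b<v = m/n<m v b 1<b

  s-step : ∀ v → s b v ≡ v % b + s b (v / b)
  s-step zero = sym (cong₂ (λ r q → r + s b q) 0%b≡0 (0/n≡0 b))
  s-step v@(suc _) = cong (v % b +_) (digitSumAux-fuel (v / b) (≤-pred (m/n<m v b 1<b)) ≤-refl)

  s-cons : ∀ {r} q → r < b → s b (r + q * b) ≡ r + s b q
  s-cons q r<b = trans (s-step _) (cong₂ (λ r′ q′ → r′ + s b q′) ([r+q*d]%d≡r q r<b) ([r+q*d]/d≡q q r<b))

  s-small : ∀ {v} → v < b → s b v ≡ v
  s-small {v} v<b = trans (cong (s b) (sym (+-identityʳ v))) (trans (s-cons 0 v<b) (+-identityʳ v))

  /-rec : (P : ℕ → Set) → P 0 → (∀ v → .{{NonZero v}} → P (v / b) → P v) → ∀ v → P v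
  /-rec P P0 step = <-rec P λ where
    zero      _   → P0
    v@(suc _) rec → step v (rec (m/n<m v b 1<b))

  s≤id : ∀ v → s b v ≤ v
  s≤id = /-rec (λ v → s b v ≤ v) ≤-refl λ v s[v/b]≤v/b → begin
    s b v               ≡⟨ s-step v ⟩
    v % b + s b (v / b) ≤⟨ +-monoʳ-≤ (v % b) (≤-trans s[v/b]≤v/b (m≤m*n (v / b) b)) ⟩
    v % b + v / b * b   ≡⟨ m≡m%n+[m/n]*n v b ⟨
    v                   ∎
    where open ≤-Reasoning

  s≡0⇒≡0 : ∀ v → s b v ≡ 0 → v ≡ 0
  s≡0⇒≡0 = /-rec (λ v → s b v ≡ 0 → v ≡ 0) (λ _ → refl) λ v ih s[v]≡0 →
    let r+s[q]≡0 = trans (sym (s-step v)) s[v]≡0 in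
    trans (m≡m%n+[m/n]*n v b)
          (cong₂ (λ r q → r + q * b) (m+n≡0⇒m≡0 (v % b) r+s[q]≡0) (ih (m+n≡0⇒n≡0 (v % b) r+s[q]≡0)))

  s-concat : ∀ j {c w} → w < b ^ j → s b (w + c * b ^ j) ≡ s b c + s b w
  s-concat zero    {c} {zero} _ = trans (cong (s b) (*-identityʳ c)) (sym (+-identityʳ (s b c)))
  s-concat zero    {w = suc _} (s≤s ())
  s-concat (suc j) {c} {w} w<bʲ⁺¹ = begin
    s b (w + c * (b * b ^ j))                 ≡⟨ cong (λ z → s b (z + c * (b * b ^ j))) (m≡m%n+[m/n]*n w b) ⟩
    s b (w % b + w / b * b + c * (b * b ^ j)) ≡⟨ cong (s b) (regroup (w % b) (w / b) c (b ^ j) b) ⟩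
    s b (w % b + (w / b + c * b ^ j) * b)     ≡⟨ s-cons (w / b + c * b ^ j) (m%n<n w b) ⟩
    w % b + s b (w / b + c * b ^ j)           ≡⟨ cong (w % b +_) (s-concat j {c} w/b<bʲ) ⟩
    w % b + (s b c + s b (w / b))             ≡⟨ x∙yz≈y∙xz (w % b) (s b c) _ ⟩
    s b c + (w % b + s b (w / b))             ≡⟨ cong (s b c +_) (s-step w) ⟨
    s b c + s b w                             ∎
    where
    open ≡-Reasoning
    regroup : ∀ r q c B b → r + q * b + c * (b * B) ≡ r + (q + c * B) * b
    regroup = solve-∀
    w/b<bʲ : w / b < b ^ j
    w/b<bʲ = m<n*o⇒m/o<n (subst (w <_) (*-comm b (b ^ j)) w<bʲ⁺¹)

  s-addDigit : ∀ {c e} → c % b + e < b → s b (c + e) ≡ s b c + e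
  s-addDigit {c} {e} no-carry = begin
    s b (c + e)                 ≡⟨ cong (λ z → s b (z + e)) (m≡m%n+[m/n]*n c b) ⟩
    s b (c % b + c / b * b + e) ≡⟨ cong (s b) (xy∙z≈xz∙y (c % b) _ e) ⟩
    s b (c % b + e + c / b * b) ≡⟨ s-cons (c / b) no-carry ⟩
    c % b + e + s b (c / b)     ≡⟨ xy∙z≈xz∙y (c % b) e _ ⟩
    c % b + s b (c / b) + e     ≡⟨ cong (_+ e) (s-step c) ⟨
    s b c + e                   ∎
    where open ≡-Reasoning

  s≤[b∸1]*j : ∀ j {w} → w < b ^ j → s b w ≤ (b ∸ 1) * j
  s≤[b∸1]*j zero    {zero}  _        = z≤n
  s≤[b∸1]*j zero    {suc _} (s≤s ())
  s≤[b∸1]*j (suc j) {w} w<bʲ⁺¹ = begin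
    s b w                   ≡⟨ s-step w ⟩
    w % b + s b (w / b)     ≤⟨ +-mono-≤ (<⇒≤pred (m%n<n w b)) (s≤[b∸1]*j j w/b<bʲ) ⟩
    (b ∸ 1) + (b ∸ 1) * j   ≡⟨ *-suc (b ∸ 1) j ⟨
    (b ∸ 1) * suc j         ∎
    where
    open ≤-Reasoning
    w/b<bʲ : w / b < b ^ j
    w/b<bʲ = m<n*o⇒m/o<n (subst (w <_) (*-comm b (b ^ j)) w<bʲ⁺¹)

  v≤f[v] : ∀ v → v ≤ f b v
  v≤f[v] v = m≤m+n v (s b v)

  -- v ≡ s(v) (mod b − 1), so for odd b both have the same parity.
  f-even : Odd b → ∀ v → Even (f b v)
  f-even odd = /-rec (λ v → Even (f b v)) (divides 0 refl) λ v 2∣f[v/b] →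
    ∣m+n∣m⇒∣n (subst (2 ∣_) (sym (f[v/b]+f[v] v))
                        (∣m∣n⇒∣m+n (n∣m*n (v % b + s b (v / b))) (∣n⇒∣m*n (v / b) odd)))
              2∣f[v/b]
    where
    regroup : ∀ x y r B → x + y + (r + x * B + (r + y)) ≡ (r + y) * 2 + x * suc B
    regroup = solve-∀
    f[v/b]+f[v] : ∀ v → f b (v / b) + f b v ≡ (v % b + s b (v / b)) * 2 + v / b * suc b
    f[v/b]+f[v] v = trans (cong₂ (λ w z → f b (v / b) + (w + z)) (m≡m%n+[m/n]*n v b) (s-step v))
                          (regroup (v / b) (s b (v / b)) (v % b) b)

  ^-odd : Odd b → ∀ j → Odd (b ^ j)
  ^-odd odd zero    = divides 1 refl
  ^-odd odd (suc j) =
    ∣m+n∣m⇒∣n (subst (2 ∣_) (regroup b (b ^ j)) (∣m∣n⇒∣m+n (∣n⇒∣m*n (suc b) (^-odd odd j)) (divides 1 refl)))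
              (∣m∣n⇒∣m+n odd (^-odd odd j))
    where
    regroup : ∀ x y → suc x * suc y + 2 ≡ suc x + suc y + suc (x * y)
    regroup = solve-∀

  preimage? : ∀ u → Decidable (λ v → f b v ≡ u)
  preimage? u v = f b v ≟ u

  F≡count : ∀ u → F b u ≡ count (preimage? u) (suc u)
  F≡count u = length-filter-upTo (preimage? u) (suc u)

  module AtPosition (j : ℕ) where

    instance
      bʲ≢0 : NonZero (b ^ j)
      bʲ≢0 = m^n≢0 b j

      bʲ⁺¹≢0 : NonZero (b ^ suc j)
      bʲ⁺¹≢0 = m^n≢0 b (suc j)

    -- Digit j of p is smaller than that of q, and all higher digits agree.
    FirstDifferenceAt : ℕ → ℕ → Set
    FirstDifferenceAt p q = p / b ^ j < q / b ^ j × p / b ^ j / b ≡ q / b ^ j / b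

    /b/bʲ≡/bʲ⁺¹ : ∀ v → v / b / b ^ j ≡ v / b ^ suc j
    /b/bʲ≡/bʲ⁺¹ v = m/n/o≡m/[n*o] v b (b ^ j)

    [c*bʲ+w]/bʲ≡c+w/bʲ : ∀ c w → (c * b ^ j + w) / b ^ j ≡ c + w / b ^ j
    [c*bʲ+w]/bʲ≡c+w/bʲ c w = trans (+-distrib-/-∣ˡ w {b ^ j} (divides-refl c)) (cong (_+ w / b ^ j) (m*n/n≡m c (b ^ j)))

    s-carryFree : ∀ {c w} → c % b + w / b ^ j < b → s b (c * b ^ j + w) ≡ s b c + s b w
    s-carryFree {c} {w} no-carry = begin
      s b (c * b ^ j + w)             ≡⟨ cong (λ z → s b (c * b ^ j + z)) (m≡m%n+[m/n]*n w (b ^ j)) ⟩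
      s b (c * b ^ j + (r + e * b ^ j)) ≡⟨ cong (s b) (regroup c r e (b ^ j)) ⟩
      s b (r + (c + e) * b ^ j)       ≡⟨ s-concat j {c + e} r<bʲ ⟩
      s b (c + e) + s b r             ≡⟨ cong (_+ s b r) (s-addDigit no-carry) ⟩
      s b c + e + s b r               ≡⟨ +-assoc (s b c) e (s b r) ⟩
      s b c + (e + s b r)             ≡⟨ cong (λ z → s b c + (z + s b r)) (s-small e<b) ⟨
      s b c + (s b e + s b r)         ≡⟨ cong (s b c +_) (s-concat j {e} r<bʲ) ⟨
      s b c + s b (r + e * b ^ j)     ≡⟨ cong (λ z → s b c + s b z) (m≡m%n+[m/n]*n w (b ^ j)) ⟨
      s b c + s b w                   ∎
      where
      open ≡-Reasoning
      r = w % b ^ j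
      e = w / b ^ j
      r<bʲ : r < b ^ j
      r<bʲ = m%n<n w (b ^ j)
      e<b : e < b
      e<b = ≤-<-trans (m≤n+m e (c % b)) no-carry
      regroup : ∀ c r e B → c * B + (r + e * B) ≡ r + (c + e) * B
      regroup = solve-∀

    f-shift : ∀ {c w} → c % b + w / b ^ j < b → f b (c * b ^ j + w) ≡ c * b ^ j + s b c + f b w
    f-shift {c} {w} no-carry = begin
      c * b ^ j + w + s b (c * b ^ j + w) ≡⟨ cong (c * b ^ j + w +_) (s-carryFree no-carry) ⟩
      c * b ^ j + w + (s b c + s b w)     ≡⟨ interchange (c * b ^ j) w (s b c) (s b w) ⟩
      c * b ^ j + s b c + (w + s b w)     ∎
      where open ≡-Reasoning

    module Collapse {u p q : ℕ} (p↦u : f b p ≡ u) (between : ∀ v → f b v ≡ u → p ≤ v × v ≤ q)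
                    (difference : FirstDifferenceAt p q) where

      c r u′ : ℕ
      c  = p / b ^ j
      r  = p % b ^ j
      u′ = f b r

      room : ∀ {v} → p ≤ v → v ≤ q → c % b + (v / b ^ j ∸ c) < b
      room p≤v v≤q = %-room (/-monoˡ-≤ (b ^ j) p≤v) (/-monoˡ-≤ (b ^ j) v≤q) (proj₂ difference)

      c%b+1<b : c % b + 1 < b
      c%b+1<b = ≤-<-trans (+-monoʳ-≤ (c % b) (m<n⇒0<n∸m (proj₁ difference)))
                          (%-room (<⇒≤ (proj₁ difference)) ≤-refl (proj₂ difference))

      u≡c*bʲ+s[c]+u′ : u ≡ c * b ^ j + s b c + u′
      u≡c*bʲ+s[c]+u′ = begin
        u                   ≡⟨ p↦u ⟨
        f b p               ≡⟨ cong (f b) (trans (m≡m%n+[m/n]*n p (b ^ j)) (+-comm r (c * b ^ j))) ⟩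
        f b (c * b ^ j + r) ≡⟨ f-shift no-carry ⟩
        c * b ^ j + s b c + u′ ∎
        where
        open ≡-Reasoning
        no-carry : c % b + r / b ^ j < b
        no-carry = subst (λ z → c % b + z < b) (sym (m<n⇒m/n≡0 (m%n<n p (b ^ j))))
                         (≤-<-trans (+-monoʳ-≤ (c % b) z≤n) c%b+1<b)

      preimage-shift : ∀ w → f b (c * b ^ j + w) ≡ u ⇔ f b w ≡ u′
      preimage-shift w = mk⇔ to from
        where
        to : f b (c * b ^ j + w) ≡ u → f b w ≡ u′
        to v↦u with p≤v , v≤q ← between _ v↦u = +-cancelˡ-≡ (c * b ^ j + s b c) _ _ (begin
          c * b ^ j + s b c + f b w ≡⟨ f-shift no-carry ⟨
          f b (c * b ^ j + w)       ≡⟨ v↦u ⟩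
          u                         ≡⟨ u≡c*bʲ+s[c]+u′ ⟩
          c * b ^ j + s b c + u′    ∎)
          where
          open ≡-Reasoning
          no-carry : c % b + w / b ^ j < b
          no-carry = subst (λ z → c % b + z < b)
                           (trans (cong (_∸ c) ([c*bʲ+w]/bʲ≡c+w/bʲ c w)) (m+n∸m≡n c _)) (room p≤v v≤q)
        from : f b w ≡ u′ → f b (c * b ^ j + w) ≡ u
        from w↦u′ = trans (f-shift no-carry) (trans (cong (c * b ^ j + s b c +_) w↦u′) (sym u≡c*bʲ+s[c]+u′))
          where
          w<2*bʲ : w < 2 * b ^ j
          w<2*bʲ = begin-strict
            w             ≤⟨ subst (w ≤_) w↦u′ (v≤f[v] w) ⟩
            r + s b r     ≤⟨ +-monoʳ-≤ r (s≤id r) ⟩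
            r + r         <⟨ +-mono-< (m%n<n p (b ^ j)) (m%n<n p (b ^ j)) ⟩
            b ^ j + b ^ j ≡⟨ cong (b ^ j +_) (+-identityʳ (b ^ j)) ⟨
            2 * b ^ j     ∎
            where open ≤-Reasoning
          no-carry : c % b + w / b ^ j < b
          no-carry = ≤-<-trans (+-monoʳ-≤ (c % b) (≤-pred (m<n*o⇒m/o<n {o = b ^ j} w<2*bʲ))) c%b+1<b

      F[u]≡F[u′] : F b u ≡ F b u′
      F[u]≡F[u′] = begin
        F b u                                              ≡⟨ F≡count u ⟩
        count (preimage? u) (suc u)                        ≡⟨ cong (count (preimage? u)) 1+u≡ ⟩
        count (preimage? u) (c * b ^ j + (s b c + suc u′)) ≡⟨ count-shift (preimage? u) below _ ⟩
        count (λ w → preimage? u (c * b ^ j + w)) (s b c + suc u′)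
          ≡⟨ count-cong (λ w → preimage? u (c * b ^ j + w)) (preimage? u′) preimage-shift (s b c + suc u′) ⟩
        count (preimage? u′) (s b c + suc u′)              ≡⟨ count-beyond (preimage? u′) beyond (s b c) ⟩
        count (preimage? u′) (suc u′)                      ≡⟨ F≡count u′ ⟨
        F b u′                                             ∎
        where
        open ≡-Reasoning
        regroup : ∀ t x y → suc (t + x + y) ≡ t + (x + suc y)
        regroup = solve-∀
        1+u≡ : suc u ≡ c * b ^ j + (s b c + suc u′)
        1+u≡ = trans (cong suc u≡c*bʲ+s[c]+u′) (regroup (c * b ^ j) (s b c) u′)
        below : ∀ v → v < c * b ^ j → ¬ f b v ≡ u
        below v v<c*bʲ v↦u = <⇒≱ (<-≤-trans v<c*bʲ (m/n*n≤m p (b ^ j))) (proj₁ (between v v↦u))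
        beyond : ∀ v → suc u′ ≤ v → ¬ f b v ≡ u′
        beyond v u′<v v↦u′ = <⇒≱ u′<v (subst (v ≤_) v↦u′ (v≤f[v] v))

      c≡0 : ∀ {n} → IsK b n u → c ≡ 0
      c≡0 (F[u]≡n , minimal) with c ≟ 0
      ... | yes c≡0 = c≡0
      ... | no c≢0  = contradiction (trans (sym F[u]≡F[u′]) F[u]≡n) (minimal u′ u′<u)
        where
        1≤c*bʲ : 1 ≤ c * b ^ j
        1≤c*bʲ = *-mono-≤ (n≢0⇒n>0 c≢0) (m^n>0 b j)
        u′<u : u′ < u
        u′<u = subst (u′ <_) (sym u≡c*bʲ+s[c]+u′) (+-monoˡ-≤ u′ (≤-trans 1≤c*bʲ (m≤m+n _ (s b c))))

    straddle : ∀ {n u p q} → IsK b n u → f b p ≡ u → (∀ v → f b v ≡ u → p ≤ v × v ≤ q) →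
               FirstDifferenceAt p q → p < b ^ j × b ^ j ≤ q
    straddle isK p↦u between difference@(p/bʲ<q/bʲ , _) =
      m/n≡0⇒m<n p/bʲ≡0 , m/n≢0⇒n≤m (λ q/bʲ≡0 → n≮0 (subst₂ _<_ p/bʲ≡0 q/bʲ≡0 p/bʲ<q/bʲ))
      where
      p/bʲ≡0 = Collapse.c≡0 p↦u between difference isK

  open AtPosition using (FirstDifferenceAt)

  firstDifference : ∀ {p q} → p < q → ∃[ j ] FirstDifferenceAt j p q
  firstDifference {q = q} = <-rec (λ q → ∀ {p} → p < q → ∃[ j ] FirstDifferenceAt j p q) step q
    where
    step : ∀ q → (∀ {q′} → q′ < q → ∀ {p} → p < q′ → ∃[ j ] FirstDifferenceAt j p q′) →
           ∀ {p} → p < q → ∃[ j ] FirstDifferenceAt j p q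
    step zero      _   ()
    step q@(suc _) rec {p} p<q with p / b ≟ q / b
    ... | yes p/b≡q/b = 0 , subst₂ _<_ (sym (n/1≡n p)) (sym (n/1≡n q)) p<q
                          , trans (/-congˡ (n/1≡n p)) (trans p/b≡q/b (/-congˡ (sym (n/1≡n q))))
    ... | no p/b≢q/b
      with j , p/b/bʲ<q/b/bʲ , p/b/bʲ/b≡q/b/bʲ/b ← rec (m/n<m q b 1<b) (≤∧≢⇒< (/-monoˡ-≤ b (<⇒≤ p<q)) p/b≢q/b) =
      suc j , subst₂ _<_ (/b/bʲ≡/bʲ⁺¹ p) (/b/bʲ≡/bʲ⁺¹ q) p/b/bʲ<q/b/bʲ
            , trans (/-congˡ (sym (/b/bʲ≡/bʲ⁺¹ p))) (trans p/b/bʲ/b≡q/b/bʲ/b (/-congˡ (/b/bʲ≡/bʲ⁺¹ q)))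
      where open AtPosition j

  K-straddles : ∀ {n u} → 2 ≤ n → IsK b n u →
                ∃[ p ] ∃[ q ] ∃[ j ] (f b p ≡ u × f b q ≡ u × p < b ^ j × b ^ j ≤ q)
  K-straddles {n} {u} 2≤n isK@(F[u]≡n , _)
    with p , q , p<q , p↦u , q↦u , extremal ←
           count≥2⇒extremes (preimage? u) (subst (2 ≤_) (trans (sym F[u]≡n) (F≡count u)) 2≤n)
    with j , difference ← firstDifference p<q =
    p , q , j , p↦u , q↦u , AtPosition.straddle j isK p↦u between difference
    where
    between : ∀ v → f b v ≡ u → p ≤ v × v ≤ q
    between v v↦u = extremal v (s≤s (subst (v ≤_) v↦u (v≤f[v] v))) v↦u

  straddle-bounds : ∀ {j u p q} → f b p ≡ u → f b q ≡ u → p < b ^ j → b ^ j ≤ q →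
                    b ^ j + 1 ≤ u × u < b ^ j + (b ∸ 1) * j
  straddle-bounds {j} {q = q} p↦u q↦u p<bʲ bʲ≤q =
    subst (b ^ j + 1 ≤_) q↦u (+-mono-≤ bʲ≤q 1≤s[q]) ,
    subst (_< b ^ j + (b ∸ 1) * j) p↦u (+-mono-<-≤ p<bʲ (s≤[b∸1]*j j p<bʲ))
    where
    1≤s[q] : 1 ≤ s b q
    1≤s[q] = n≢0⇒n>0 λ s[q]≡0 → <⇒≱ (m^n>0 b j) (subst (b ^ j ≤_) (s≡0⇒≡0 q s[q]≡0) bʲ≤q)

offset-bounds : ∀ {B m u} → B + 1 ≤ u → u < B + m → ∃[ k ] (k + 2 ≤ m × u ≡ B + 1 + k)
offset-bounds {B} {m} {u} B+1≤u u<B+m = u ∸ (B + 1) , +-cancelˡ-≤ B _ _ B+k+2≤B+m , sym u≡B+1+k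
  where
  u≡B+1+k : B + 1 + (u ∸ (B + 1)) ≡ u
  u≡B+1+k = m+[n∸m]≡n B+1≤u
  regroup : ∀ x k → x + (k + 2) ≡ suc (x + 1 + k)
  regroup = solve-∀
  B+k+2≤B+m : B + (u ∸ (B + 1) + 2) ≤ B + m
  B+k+2≤B+m = subst (_≤ B + m) (sym (trans (regroup B _) (cong suc u≡B+1+k))) u<B+m

0<m*n⇒0<n : ∀ m {n} → 0 < m * n → 0 < n
0<m*n⇒0<n m {zero}  0<m*0 = contradiction (subst (0 <_) (*-zeroʳ m) 0<m*0) n≮0
0<m*n⇒0<n m {suc n} _     = s≤s z≤n

theorem4p1 : (b : ℕ) .{{_ : NonZero b}} → 2 ≤ b → (n : ℕ) → 2 ≤ n →
    (u : ℕ) → IsK b n u →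
    ∃[ m ] ∃[ k ] (1 ≤ m × k + 2 ≤ (b ∸ 1) * m × u ≡ b ^ m + 1 + k
      × (Odd b → Even u × Even k))
theorem4p1 b 1<b n 2≤n u isK =
  let open DigitSum b 1<b
      p , q , j , p↦u , q↦u , p<bʲ , bʲ≤q = K-straddles 2≤n isK
      bʲ+1≤u , u<bʲ+[b∸1]j = straddle-bounds {j} p↦u q↦u p<bʲ bʲ≤q
      k , k+2≤[b∸1]j , u≡bʲ+1+k = offset-bounds bʲ+1≤u u<bʲ+[b∸1]j
      parity : Odd b → Even u × Even k
      parity odd = let 2∣u = subst Even p↦u (f-even odd p) in
        2∣u , ∣m+n∣m⇒∣n (subst Even u≡bʲ+1+k 2∣u) (subst (2 ∣_) (+-comm 1 (b ^ j)) (^-odd odd j))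
  in j , k , 0<m*n⇒0<n (b ∸ 1) {j} (≤-trans (s≤s z≤n) (≤-trans (m≤n+m 2 k) k+2≤[b∸1]j)) , k+2≤[b∸1]j , u≡bʲ+1+k , parity
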